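{- Let $G=(V,E)$ be a finite graph. Then $\overline v(G)=\min\{|U| : U\subseteq\mathcal C(G)\text{ is a maximal independent set in }C_G\}\le\alpha(C_G)$.
   Context: $\mathcal C(G)$ is the set of cliques of $G$ with at least two vertices. The clique graph $C_G$ has vertex set $\mathcal C(G)$, with $A,B$ adjacent iff $|A\cap B|\ge2$. $\overline v(G)$ is the minimum $r$ such that there are $C_1,\dots,C_r\in\mathcal C(G)$ with each edge of $G$ contained in exactly one $C_i$. $\alpha(H)$ is the independence number of $H$; a maximal independent set is an independent set not properly contained in another independent set. -}

module Defs where

open import Data.Nat using (ℕ; _≤_)
open import Data.Bool using (Bool; true; false)
open import Data.Fin using (Fin)
open import Data.Fin.Subset using (Subset; _∈_; _∉_; _∩_; ∣_∣)
open import Data.List using (List; _∷_; length; lookup)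
open import Data.List.Relation.Unary.All using (All)
open import Data.List.Relation.Unary.AllPairs using (AllPairs)
open import Data.List.Membership.Propositional renaming (_∈_ to _∈ₗ_; _∉_ to _∉ₗ_)
open import Data.Product using (Σ; _×_; ∃)
open import Relation.Binary.PropositionalEquality using (_≡_; _≢_)
open import Relation.Nullary using (¬_)

record Graph (n : ℕ) : Set where
  field
    adj   : Fin n → Fin n → Bool
    sym   : ∀ x y → adj x y ≡ adj y x
    irref : ∀ x → adj x x ≡ false

module _ {n : ℕ} (G : Graph n) where
  open Graph G

  Edge : Fin n → Fin n → Set
  Edge x y = adj x y ≡ true

  -- 𝒞(G): cliques (complete vertex subsets, not necessarily maximal)
  -- with at least two vertices.
  IsClique : Subset n → Set
  IsClique S = (2 ≤ ∣ S ∣) × (∀ x y → x ∈ S → y ∈ S → x ≢ y → Edge x y)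

  CAdj : Subset n → Subset n → Set
  CAdj A B = 2 ≤ ∣ A ∩ B ∣

  -- U ⊆ 𝒞(G) is an independent set of C_G (the list has pairwise
  -- non-adjacent entries; this forces the entries to be distinct,
  -- since a clique A has |A ∩ A| ≥ 2, so length U = |U|).
  IsIndependent : List (Subset n) → Set
  IsIndependent U = All IsClique U × AllPairs (λ A B → ¬ CAdj A B) U

  IsMaximalIndependent : List (Subset n) → Set
  IsMaximalIndependent U =
    IsIndependent U × (∀ C → IsClique C → C ∉ₗ U → ¬ IsIndependent (C ∷ U))

  IsEdgeCliquePartition : List (Subset n) → Set
  IsEdgeCliquePartition Cs =
    All IsClique Cs ×
    (∀ x y → Edge x y →
      Σ (Fin (length Cs)) λ i →
        (x ∈ lookup Cs i × y ∈ lookup Cs i) ×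
        (∀ j → x ∈ lookup Cs j → y ∈ lookup Cs j → j ≡ i))

  IsVBar : ℕ → Set
  IsVBar r = (Σ (List (Subset n)) λ Cs → IsEdgeCliquePartition Cs × length Cs ≡ r)
           × (∀ Cs → IsEdgeCliquePartition Cs → r ≤ length Cs)

  IsMinMaxIndep : ℕ → Set
  IsMinMaxIndep m = (Σ (List (Subset n)) λ U → IsMaximalIndependent U × length U ≡ m)
                  × (∀ U → IsMaximalIndependent U → m ≤ length U)

  IsAlpha : ℕ → Set
  IsAlpha a = (Σ (List (Subset n)) λ U → IsIndependent U × length U ≡ a)
            × (∀ U → IsIndependent U → length U ≤ a)

{-# OPTIONS --safe #-}
-- Two cliques are adjacent in C_G exactly when they share an edge. So a list of cliques is
-- independent in C_G iff no edge lies in two of its members, and an independent list is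
-- maximal iff every edge lies in one of its members: an uncovered edge xy is itself a clique
-- meeting every member in at most one vertex, while a clique always contains an edge, and
-- the member covering that edge is adjacent to it. Hence edge clique partitions are exactly
-- the maximal independent sets of C_G, and v̄(G) is the least size of one. Independent lists
-- consist of distinct subsets of Fin n, so their length is at most 2 ^ n and α(C_G) exists;
-- a largest independent set is maximal, which gives both the existence of the minimum and
-- the bound by α(C_G).
module Submission where

open import Defs
open import Data.Nat using (ℕ; _≤_)
open import Data.Product using (Σ; _×_)

open import Data.Bool as Bool using (Bool; true; false)
open import Data.Empty using (⊥-elim)
open import Data.Fin as Fin using (Fin; zero; suc; combine)
open import Data.Fin.Properties using (all?; pigeonhole; combine-injective; <-cmp)
  renaming (suc-injective to Fin-suc-injective)
open import Data.Fin.Subset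
  using (Subset; inside; outside; _∈_; _∩_; _∪_; ⁅_⁆; ∣_∣; _⊆_; Nonempty)
open import Data.Fin.Subset.Properties
  using (_∈?_; anySubset?; x∈⁅x⁆; x∈⁅y⁆⇒x≡y; x≢y⇒x∉⁅y⁆; ∣⁅x⁆∣≡1; p⊂q⇒∣p∣<∣q∣;
         ∩-idem; x∈p∩q⁺; x∈p∩q⁻; x∈p∪q⁺; x∈p∪q⁻)
open import Data.List using (List; []; _∷_; length; lookup)
open import Data.List.Properties using (tabulate-lookup)
open import Data.List.Membership.Propositional using (lose) renaming (_∉_ to _∉ₗ_)
open import Data.List.Membership.Propositional.Properties using (∈-lookup)
open import Data.List.Relation.Unary.All as All using (All; []; _∷_)
open import Data.List.Relation.Unary.All.Properties using (All¬⇒¬Any)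
open import Data.List.Relation.Unary.AllPairs as AllPairs using (AllPairs; []; _∷_)
import Data.List.Relation.Unary.AllPairs.Properties as AllPairs
open import Data.List.Relation.Unary.Any as Any using (Any)
open import Data.List.Relation.Unary.Any.Properties using (lookup-index)
open import Data.List.Relation.Unary.Unique.Propositional using (Unique)
open import Data.Nat using (zero; suc; _<_; _^_; s≤s; _≤?_)
open import Data.Nat.Induction using (<-rec)
open import Data.Nat.Properties using (≮⇒≥; ≤-pred; ≤∧≢⇒<; 1+n≰n; suc-injective; anyUpTo?)
open import Data.Product using (∃₂; _,_; proj₁)
open import Data.Sum using (_⊎_; inj₁; inj₂)
open import Data.Vec.Base using ([]; _∷_; here; there)
open import Data.Vec.Properties using (≡-dec)
open import Function using (_∘_)
open import Relation.Binary.Definitions using (tri<; tri≈; tri>)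
open import Relation.Binary.PropositionalEquality
  using (_≡_; _≢_; refl; sym; trans; cong₂; subst; ≢-sym)
open import Relation.Nullary using (¬_; Dec; yes; no; contradiction)
open import Relation.Nullary.Decidable using (_×-dec_; _→-dec_; ¬?; decidable-stable)
open import Relation.Unary using (Decidable)

private
  variable
    n : ℕ
    x y : Fin n
    p : Subset n

1≤∣p∣⇒nonempty : 1 ≤ ∣ p ∣ → Nonempty p
1≤∣p∣⇒nonempty {p = inside  ∷ p} _ = zero , here
1≤∣p∣⇒nonempty {p = outside ∷ p} 1≤∣p∣ with x , x∈p ← 1≤∣p∣⇒nonempty 1≤∣p∣ = suc x , there x∈p

2≤∣p∣⇒distinct-members : 2 ≤ ∣ p ∣ → ∃₂ λ x y → x ≢ y × x ∈ p × y ∈ p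
2≤∣p∣⇒distinct-members {p = inside ∷ p} (s≤s 1≤∣p∣)
  with y , y∈p ← 1≤∣p∣⇒nonempty 1≤∣p∣ = zero , suc y , (λ ()) , here , there y∈p
2≤∣p∣⇒distinct-members {p = outside ∷ p} 2≤∣p∣
  with x , y , x≢y , x∈p , y∈p ← 2≤∣p∣⇒distinct-members 2≤∣p∣ =
  suc x , suc y , x≢y ∘ Fin-suc-injective , there x∈p , there y∈p

distinct-members⇒2≤∣p∣ : x ≢ y → x ∈ p → y ∈ p → 2 ≤ ∣ p ∣
distinct-members⇒2≤∣p∣ {x = x} {y} {p} x≢y x∈p y∈p =
  subst (_< ∣ p ∣) (∣⁅x⁆∣≡1 x) (p⊂q⇒∣p∣<∣q∣ (⁅x⁆⊆p , y , y∈p , x≢y⇒x∉⁅y⁆ (≢-sym x≢y)))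
  where
  ⁅x⁆⊆p : ⁅ x ⁆ ⊆ p
  ⁅x⁆⊆p z∈⁅x⁆ = subst (_∈ p) (sym (x∈⁅y⁆⇒x≡y x z∈⁅x⁆)) x∈p

∈⁅x⁆∪⁅y⁆⇒≡ : ∀ {z} → z ∈ ⁅ x ⁆ ∪ ⁅ y ⁆ → z ≡ x ⊎ z ≡ y
∈⁅x⁆∪⁅y⁆⇒≡ {x = x} {y} z∈ with x∈p∪q⁻ ⁅ x ⁆ ⁅ y ⁆ z∈
... | inj₁ z∈⁅x⁆ = inj₁ (x∈⁅y⁆⇒x≡y x z∈⁅x⁆)
... | inj₂ z∈⁅y⁆ = inj₂ (x∈⁅y⁆⇒x≡y y z∈⁅y⁆)

Both : Fin n → Fin n → Subset n → Set
Both x y p = x ∈ p × y ∈ p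

both-∈⁅x⁆∪⁅y⁆ : Both x y (⁅ x ⁆ ∪ ⁅ y ⁆)
both-∈⁅x⁆∪⁅y⁆ {x = x} {y} = x∈p∪q⁺ (inj₁ (x∈⁅x⁆ x)) , x∈p∪q⁺ (inj₂ (x∈⁅x⁆ y))

distinct-∈⁅x⁆∪⁅y⁆ : ∀ {a b} → a ≢ b → Both a b (⁅ x ⁆ ∪ ⁅ y ⁆) →
                    (a ≡ x × b ≡ y) ⊎ (a ≡ y × b ≡ x)
distinct-∈⁅x⁆∪⁅y⁆ a≢b (a∈ , b∈) with ∈⁅x⁆∪⁅y⁆⇒≡ a∈ | ∈⁅x⁆∪⁅y⁆⇒≡ b∈
... | inj₁ refl | inj₁ refl = contradiction refl a≢b
... | inj₁ a≡x  | inj₂ b≡y  = inj₁ (a≡x , b≡y)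
... | inj₂ a≡y  | inj₁ b≡x  = inj₂ (a≡y , b≡x)
... | inj₂ refl | inj₂ refl = contradiction refl a≢b

distinct-∈⁅x⁆∪⁅y⁆⇒both : ∀ {a b} → a ≢ b → Both a b (⁅ x ⁆ ∪ ⁅ y ⁆) → Both a b p → Both x y p
distinct-∈⁅x⁆∪⁅y⁆⇒both a≢b ab∈ (a∈p , b∈p) with distinct-∈⁅x⁆∪⁅y⁆ a≢b ab∈
... | inj₁ (refl , refl) = a∈p , b∈p
... | inj₂ (refl , refl) = b∈p , a∈p

bit : Bool → Fin 2
bit false = zero
bit true  = suc zero

bit-injective : ∀ {a b} → bit a ≡ bit b → a ≡ b
bit-injective {false} {false} _ = refl
bit-injective {true}  {true}  _ = refl

encode : Subset n → Fin (2 ^ n)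
encode []      = zero
encode (b ∷ p) = combine (bit b) (encode p)

encode-injective : ∀ (p q : Subset n) → encode p ≡ encode q → p ≡ q
encode-injective []      []      _  = refl
encode-injective (a ∷ p) (b ∷ q) eq
  with a≡b , ep≡eq ← combine-injective (bit a) (encode p) (bit b) (encode q) eq =
  cong₂ _∷_ (bit-injective a≡b) (encode-injective p q ep≡eq)

AllPairs-lookup : ∀ {A : Set} {R : A → A → Set} {xs : List A} →
                  AllPairs R xs → ∀ {i j} → i Fin.< j → R (lookup xs i) (lookup xs j)
AllPairs-lookup (Rx ∷ _)   {zero}  {suc j} _         = All.lookup Rx (∈-lookup j)
AllPairs-lookup (_  ∷ Rxs) {suc i} {suc j} (s≤s i<j) = AllPairs-lookup Rxs i<j

unique⇒length≤2^n : {ps : List (Subset n)} → Unique ps → length ps ≤ 2 ^ n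
unique⇒length≤2^n {n} {ps} unique = ≮⇒≥ too-long
  where
  too-long : ¬ (2 ^ n < length ps)
  too-long 2^n<len
    with i , j , i<j , same-code ← pigeonhole 2^n<len (encode ∘ lookup ps) =
    AllPairs-lookup unique i<j
      (encode-injective (lookup ps i) (lookup ps j) same-code)

allSubsets? : {P : Subset n → Set} → Decidable P → Dec (∀ p → P p)
allSubsets? P? with anySubset? (¬? ∘ P?)
... | yes (p , ¬Pp) = no λ all → ¬Pp (all p)
... | no  ¬∃¬P      = yes λ p → decidable-stable (P? p) (λ ¬Pp → ¬∃¬P (p , ¬Pp))

Realised : (List (Subset n) → Set) → ℕ → Set
Realised {n} R k = Σ (List (Subset n)) λ ps → R ps × length ps ≡ k

realised? : {R : List (Subset n) → Set} → Decidable R → Decidable (Realised R)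
realised? R? zero with R? []
... | yes R[] = yes ([] , R[] , refl)
... | no ¬R[] = no λ { ([] , R[] , refl) → ¬R[] R[] }
realised? R? (suc k) with anySubset? (λ p → realised? (λ ps → R? (p ∷ ps)) k)
... | yes (p , ps , R[p∷ps] , refl) = yes (p ∷ ps , R[p∷ps] , refl)
... | no ¬∃ = no λ { (p ∷ ps , R[p∷ps] , len) → ¬∃ (p , ps , R[p∷ps] , suc-injective len) }

Minimum : (ℕ → Set) → Set
Minimum P = Σ ℕ λ r → P r × (∀ j → P j → r ≤ j)

module _ {P : ℕ → Set} (P? : Decidable P) where

  least : ∀ m → P m → Minimum P
  least = <-rec (λ m → P m → Minimum P) step
    where
    step : ∀ m → (∀ {j} → j < m → P j → Minimum P) → P m → Minimum P
    step m below Pm with anyUpTo? P? m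
    ... | yes (j , j<m , Pj) = below j<m Pj
    ... | no  ¬∃            = m , Pm , λ j Pj → ≮⇒≥ (λ j<m → ¬∃ (j , j<m , Pj))

  greatest-≤ : P 0 → ∀ b → Σ ℕ λ a → P a × (∀ j → j ≤ b → P j → j ≤ a)
  greatest-≤ P0 zero = 0 , P0 , λ _ j≤0 _ → j≤0
  greatest-≤ P0 (suc b) with P? (suc b)
  ... | yes P[1+b] = suc b , P[1+b] , λ _ j≤1+b _ → j≤1+b
  ... | no ¬P[1+b] =
    let a , Pa , below = greatest-≤ P0 b
    in  a , Pa , λ j j≤1+b Pj → below j (≤-pred (≤∧≢⇒< j≤1+b λ { refl → ¬P[1+b] Pj })) Pj

module _ {n : ℕ} (G : Graph n) where
  open Graph G using (adj; irref) renaming (sym to adj-sym)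

  private
    variable
      A B : Subset n
      U Cs : List (Subset n)

  edge⇒≢ : Edge G x y → x ≢ y
  edge⇒≢ {x} xy refl = contradiction (trans (sym xy) (irref x)) λ ()

  clique-edge : IsClique G A → x ≢ y → Both x y A → Edge G x y
  clique-edge (_ , complete) x≢y (x∈A , y∈A) = complete _ _ x∈A y∈A x≢y

  edge⇒clique : Edge G x y → IsClique G (⁅ x ⁆ ∪ ⁅ y ⁆)
  edge⇒clique {x} {y} xy =
    let x∈E , y∈E = both-∈⁅x⁆∪⁅y⁆
    in  distinct-members⇒2≤∣p∣ (edge⇒≢ xy) x∈E y∈E ,
        λ a b a∈E b∈E a≢b → edge (distinct-∈⁅x⁆∪⁅y⁆ a≢b (a∈E , b∈E))
    where
    edge : ∀ {a b} → (a ≡ x × b ≡ y) ⊎ (a ≡ y × b ≡ x) → Edge G a b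
    edge (inj₁ (refl , refl)) = xy
    edge (inj₂ (refl , refl)) = trans (adj-sym y x) xy

  clique⇒CAdj-self : IsClique G A → CAdj G A A
  clique⇒CAdj-self {A} (2≤∣A∣ , _) = subst (λ S → 2 ≤ ∣ S ∣) (sym (∩-idem A)) 2≤∣A∣

  CAdj⇒shared-pair : CAdj G A B → ∃₂ λ x y → x ≢ y × Both x y A × Both x y B
  CAdj⇒shared-pair {A} {B} adjacent =
    let x , y , x≢y , x∈A∩B , y∈A∩B = 2≤∣p∣⇒distinct-members adjacent
        x∈A , x∈B = x∈p∩q⁻ A B x∈A∩B
        y∈A , y∈B = x∈p∩q⁻ A B y∈A∩B
    in  x , y , x≢y , (x∈A , y∈A) , (x∈B , y∈B)

  shared-pair⇒CAdj : x ≢ y → Both x y A → Both x y B → CAdj G A B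
  shared-pair⇒CAdj x≢y (x∈A , y∈A) (x∈B , y∈B) =
    distinct-members⇒2≤∣p∣ x≢y (x∈p∩q⁺ (x∈A , x∈B)) (x∈p∩q⁺ (y∈A , y∈B))

  independent⇒unique : IsIndependent G U → Unique U
  independent⇒unique ([] , []) = []
  independent⇒unique {A ∷ _} (A-clique ∷ cliques , A-nonadjacent ∷ nonadjacent) =
    All.map (λ ¬adjacent A≡B → ¬adjacent (subst (CAdj G A) A≡B (clique⇒CAdj-self A-clique)))
            A-nonadjacent
    ∷ independent⇒unique (cliques , nonadjacent)

  independent⇒length≤2^n : IsIndependent G U → length U ≤ 2 ^ n
  independent⇒length≤2^n = unique⇒length≤2^n ∘ independent⇒unique

  Covers : List (Subset n) → Set
  Covers U = ∀ x y → Edge G x y → Any (Both x y) U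

  independent⇒edge-in-at-most-one : IsIndependent G U → Edge G x y → ∀ i j →
                                    Both x y (lookup U i) → Both x y (lookup U j) → i ≡ j
  independent⇒edge-in-at-most-one (_ , nonadjacent) xy i j xy∈i xy∈j with <-cmp i j
  ... | tri< i<j _ _ = contradiction (shared-pair⇒CAdj (edge⇒≢ xy) xy∈i xy∈j)
                                     (AllPairs-lookup nonadjacent i<j)
  ... | tri≈ _ i≡j _ = i≡j
  ... | tri> _ _ j<i = contradiction (shared-pair⇒CAdj (edge⇒≢ xy) xy∈j xy∈i)
                                     (AllPairs-lookup nonadjacent j<i)

  independent∧covers⇒partition : IsIndependent G U → Covers U → IsEdgeCliquePartition G U
  independent∧covers⇒partition indep@(cliques , _) covers = cliques , λ x y xy →
    let covered = covers x y xy
        i       = Any.index covered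
        xy∈i    = lookup-index covered
    in  i , xy∈i , λ j x∈j y∈j → independent⇒edge-in-at-most-one indep xy j i (x∈j , y∈j) xy∈i

  partition⇒independent : IsEdgeCliquePartition G Cs → IsIndependent G Cs
  partition⇒independent {Cs} (cliques , partition) =
    cliques , subst (AllPairs _) (tabulate-lookup Cs) (AllPairs.tabulate⁺ nonadjacent)
    where
    nonadjacent : ∀ {i j} → i ≢ j → ¬ CAdj G (lookup Cs i) (lookup Cs j)
    nonadjacent {i} {j} i≢j adjacent =
      let x , y , x≢y , xy∈i , xy∈j = CAdj⇒shared-pair adjacent
          xy = clique-edge (All.lookup cliques (∈-lookup i)) x≢y xy∈i
          _ , _ , unique = partition x y xy
          x∈i , y∈i = xy∈i
          x∈j , y∈j = xy∈j
      in  i≢j (trans (unique i x∈i y∈i) (sym (unique j x∈j y∈j)))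

  partition⇒covers : IsEdgeCliquePartition G Cs → Covers Cs
  partition⇒covers (_ , partition) x y xy =
    let i , xy∈i , _ = partition x y xy in lose (∈-lookup i) xy∈i

  covers⇒maximal : IsIndependent G U → Covers U → IsMaximalIndependent G U
  covers⇒maximal indep covers = indep , λ { C C-clique _ (_ , C-nonadjacent ∷ _) →
    let x , y , x≢y , x∈C , y∈C = 2≤∣p∣⇒distinct-members (proj₁ C-clique)
        covered = covers x y (clique-edge C-clique x≢y (x∈C , y∈C))
    in  All¬⇒¬Any C-nonadjacent (Any.map (shared-pair⇒CAdj x≢y (x∈C , y∈C)) covered) }

  maximal⇒covers : IsMaximalIndependent G U → Covers U
  maximal⇒covers {U} ((cliques , nonadjacent) , maximal) x y xy
    with Any.any? (λ A → (x ∈? A) ×-dec (y ∈? A)) U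
  ... | yes covered   = covered
  ... | no  uncovered =
    ⊥-elim (maximal E (edge⇒clique xy) E∉U (edge⇒clique xy ∷ cliques , E-nonadjacent ∷ nonadjacent))
    where
    E : Subset n
    E = ⁅ x ⁆ ∪ ⁅ y ⁆
    E∉U : E ∉ₗ U
    E∉U E∈U = uncovered (lose E∈U both-∈⁅x⁆∪⁅y⁆)
    E-nonadjacent : All (λ B → ¬ CAdj G E B) U
    E-nonadjacent = All.tabulate λ B∈U adjacent →
      let a , b , a≢b , ab∈E , ab∈B = CAdj⇒shared-pair adjacent
      in  uncovered (lose B∈U (distinct-∈⁅x⁆∪⁅y⁆⇒both a≢b ab∈E ab∈B))

  partition⇒maximal : IsEdgeCliquePartition G Cs → IsMaximalIndependent G Cs
  partition⇒maximal partition =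
    covers⇒maximal (partition⇒independent partition) (partition⇒covers partition)

  maximal⇒partition : IsMaximalIndependent G U → IsEdgeCliquePartition G U
  maximal⇒partition maximal =
    independent∧covers⇒partition (proj₁ maximal) (maximal⇒covers maximal)

  minMaxIndep⇒vBar : ∀ {r} → IsMinMaxIndep G r → IsVBar G r
  minMaxIndep⇒vBar ((U , maximal , len) , smallest) =
    (U , maximal⇒partition maximal , len) ,
    λ Cs partition → smallest Cs (partition⇒maximal partition)

  largest-independent⇒maximal : IsIndependent G U →
                                (∀ V → IsIndependent G V → length V ≤ length U) →
                                IsMaximalIndependent G U
  largest-independent⇒maximal indep largest = indep , λ C _ _ indep′ → 1+n≰n (largest (C ∷ _) indep′)

  isClique? : Decidable (IsClique G)
  isClique? A = (2 ≤? ∣ A ∣) ×-dec all? λ x → all? λ y →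
    x ∈? A →-dec y ∈? A →-dec ¬? (x Fin.≟ y) →-dec adj x y Bool.≟ true

  isIndependent? : Decidable (IsIndependent G)
  isIndependent? U = All.all? isClique? U ×-dec AllPairs.allPairs? (λ A B → ¬? (2 ≤? ∣ A ∩ B ∣)) U

  isMaximalIndependent? : Decidable (IsMaximalIndependent G)
  isMaximalIndependent? U = isIndependent? U ×-dec allSubsets? λ C →
    isClique? C →-dec ¬? (Any.any? (≡-dec Bool._≟_ C) U) →-dec ¬? (isIndependent? (C ∷ U))

  independence-number : Σ ℕ (IsAlpha G)
  independence-number =
    let a , (U , indep , len) , below =
          greatest-≤ (realised? isIndependent?) ([] , ([] , []) , refl) (2 ^ n)
    in  a , (U , indep , len) ,
        λ V indep′ → below (length V) (independent⇒length≤2^n indep′) (V , indep′ , refl)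

mainTheorem10 : (n : ℕ) (G : Graph n) →
    Σ ℕ λ r → IsVBar G r × IsMinMaxIndep G r ×
    (Σ ℕ λ a → IsAlpha G a × r ≤ a)
mainTheorem10 n G
  with a , alpha@((U₀ , independent₀ , refl) , largest) ← independence-number G =
  let maximal₀ = largest-independent⇒maximal G independent₀ largest
      r , realised , smallest = least (realised? (isMaximalIndependent? G)) a (U₀ , maximal₀ , refl)
      minMax = realised , λ U maximal → smallest (length U) (U , maximal , refl)
  in  r , minMaxIndep⇒vBar G minMax , minMax , a , alpha , smallest a (U₀ , maximal₀ , refl)
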